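{- Fix an integer $N\geq 2$. For all $c\in(0,1]$, \[ \liminf_{n\to\infty}\frac{f(n,c)}{\log_2 n}\geq 1, \] where $f(n,c):=\inf\{M(S)\mid S\subseteq\{0,1,\dots,N-1\}^n,\ \delta(S)\geq c\}$.
   Context: For $S\subseteq\{0,1,\dots,N-1\}^n$, $\delta(S)=|S|/N^n$. For a finite set $S\subseteq\mathbb{Z}^n$, $M(S):=M(\mathrm{Conv}(S))$, where for an integral convex polytope $P\subseteq\mathbb{R}^n$, $M(P)$ is the largest integer $m$ such that there is a unimodular affine transformation $A$ (an affine map $x\mapsto Bx+z$ with $B$ an injective integer $n\times m$ matrix and $z\in\mathbb{Z}^n$) with $A([0,1]^m)\subseteq P$.
   Formalization: The density threshold c ranges only over the rational numbers in $(0,1]$. -}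

module Defs where

open import Data.Nat as ℕ using (ℕ; zero; suc; _^_)
open import Data.Integer as ℤ using (ℤ)
open import Data.Rational as ℚ using (ℚ; 0ℚ; 1ℚ)
open import Data.Fin using (Fin; zero; suc; toℕ)
open import Data.Bool using (Bool; true; false)
open import Data.Vec using (Vec; lookup)
open import Data.List using (List; length; foldr; zipWith)
open import Data.List.Relation.Unary.All using (All)
open import Data.List.Relation.Unary.Unique.Propositional using (Unique)
open import Data.Product using (Σ; _×_; ∃)
open import Relation.Binary.PropositionalEquality using (_≡_)

sumFinℤ : (m : ℕ) → (Fin m → ℤ) → ℤ
sumFinℤ zero    f = ℤ.+ 0
sumFinℤ (suc m) f = f zero ℤ.+ sumFinℤ m (λ j → f (suc j))

sumℚ : List ℚ → ℚ
sumℚ = foldr ℚ._+_ 0ℚ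

Pt : ℕ → Set
Pt n = Fin n → ℤ

-- A finite subset of {0,…,N-1}^n: a duplicate-free list of vectors.
-- Each element s encodes the point i ↦ toℕ (lookup s i).
record GridSet (N n : ℕ) : Set where
  constructor gridSet
  field
    elems  : List (Vec (Fin N) n)
    unique : Unique elems
open GridSet public

toℚ : ℤ → ℚ
toℚ z = z ℚ./ 1

coordℚ : ∀ {N n} → Vec (Fin N) n → Fin n → ℚ
coordℚ s i = toℚ (ℤ.+ toℕ (lookup s i))

-- δ(S) ≥ p/q, i.e. |S| / N^n ≥ p / q, i.e. q·|S| ≥ p·N^n.
DensityAtLeast : ∀ {N n} → GridSet N n → (p q : ℕ) → Set
DensityAtLeast {N} {n} S p q = p ℕ.* (N ^ n) ℕ.≤ q ℕ.* length (elems S)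

-- x ∈ Conv(S): x is a convex combination of the points of S
-- (nonnegative rational weights summing to 1; for a rational point and a
-- finite set of rational points this is equivalent to real convex hull membership).
InConv : ∀ {N n} → GridSet N n → Pt n → Set
InConv {N} {n} S x =
  Σ (List ℚ) λ ws →
    (length ws ≡ length (elems S)) ×
    All (0ℚ ℚ.≤_) ws ×
    (sumℚ ws ≡ 1ℚ) ×
    ((i : Fin n) → sumℚ (zipWith (λ w s → w ℚ.* coordℚ s i) ws (elems S)) ≡ toℚ (x i))

bit : Bool → ℤ
bit true  = ℤ.+ 1
bit false = ℤ.+ 0

Mat : ℕ → ℕ → Set
Mat n m = Fin n → Fin m → ℤ

apply : ∀ {n m} → Mat n m → (Fin m → ℤ) → Pt n
apply {n} {m} B u i = sumFinℤ m (λ j → B i j ℤ.* u j)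

InjectiveMat : ∀ {n m} → Mat n m → Set
InjectiveMat {n} {m} B =
  (u v : Fin m → ℤ) → ((i : Fin n) → apply B u i ≡ apply B v i) → (j : Fin m) → u j ≡ v j

-- The unimodular affine map A(x) = Bx + z sends [0,1]^m into Conv(S).
-- Since Conv(S) is convex and A([0,1]^m) is the convex hull of the images of
-- the 2^m vertices {0,1}^m, this is equivalent to all vertex images lying in Conv(S).
CubeIn : ∀ {N n} → GridSet N n → (m : ℕ) → Mat n m → Pt n → Set
CubeIn {N} {n} S m B z =
  (σ : Fin m → Bool) → InConv S (λ i → z i ℤ.+ apply B (λ j → bit (σ j)) i)

HasCube : ∀ {N n} → GridSet N n → ℕ → Set
HasCube {N} {n} S m = Σ (Mat n m) λ B → Σ (Pt n) λ z → InjectiveMat B × CubeIn S m B z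

IsM : ∀ {N n} → GridSet N n → ℕ → Set
IsM S m = HasCube S m × (∀ m′ → HasCube S m′ → m′ ℕ.≤ m)

-- f(n,c) ≥ k for c = p/q: every S ⊆ {0..N-1}^n with δ(S) ≥ c has M(S) ≥ k.
fAtLeast : (N n p q k : ℕ) → Set
fAtLeast N n p q k = (S : GridSet N n) → DensityAtLeast S p q → (m : ℕ) → IsM S m → k ℕ.≤ m

{-# OPTIONS --safe #-}
module Submission where

-- Write [N] = {0,…,N-1}. If S ⊆ [N]^(t+r) has density at least 2^-e and N^t ≥ 2^(e+1),
-- Cauchy–Schwarz on the fibre sizes s(y) = #{u ∈ [N]^t | (u,y) ∈ S} shows that two distinct
-- u ≠ v have a common fibre {y | (u,y), (v,y) ∈ S} of density at least 2^-(2e+1) in [N]^r.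
-- Iterating d times inside that fibre, with blocks of lengths e+1, 2e+2, 4e+4, …, yields pairs
-- uᵢ ≠ vᵢ in disjoint blocks and a base point y such that all 2^d points obtained by choosing uᵢ
-- or vᵢ in every block lie in S. These are the vertices z + Bσ, σ ∈ {0,1}^d, of a parallelepiped
-- whose i-th edge vᵢ - uᵢ lives in block i, so B is injective and M(S) ≥ d. Density p/q ≥ 2^-q
-- and d ≈ log₂ (n/(q+1)) then give M(S) ≥ (1 - a/b) log₂ n.

open import Defs
open import Data.Nat using (ℕ; _≤_; _^_; _*_; _∸_; _≥_)
open import Data.Product using (Σ; _×_)

open import Data.Nat using (zero; suc; _+_; _<_; _<?_; NonZero; z≤n; s≤s; z<s; >-nonZero)
open import Data.Nat.Properties
open import Data.Nat.Tactic.RingSolver using (solve-∀)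
open import Data.Integer as ℤ using (ℤ; 0ℤ; ≢-nonZero)
import Data.Integer.Properties as ℤₚ
import Data.Integer.Tactic.RingSolver as ℤ-Solver
open import Data.Rational as ℚ using (ℚ; 0ℚ; 1ℚ)
import Data.Rational.Properties as ℚₚ
open import Data.Bool using (Bool; true; false; _∧_; if_then_else_; T)
open import Data.Bool.Properties using (∧-idem; T-∧)
open import Data.Fin using (Fin; zero; suc; toℕ; _↑ˡ_; _↑ʳ_; splitAt; join)
import Data.Fin.Properties as Fin
open import Data.Vec using (Vec; []; _∷_; _++_; lookup; tabulate)
import Data.Vec.Properties as Vec
import Data.Vec.Functional as Vector
import Data.Vec.Functional.Properties as Vector
open import Data.List using (List; []; _∷_; length; replicate; zipWith)
open import Data.List.Properties using (length-replicate)
open import Data.List.Relation.Unary.All using (All; _∷_)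
open import Data.List.Relation.Unary.All.Properties using (replicate⁺; All¬⇒¬Any)
open import Data.List.Relation.Unary.AllPairs using (_∷_)
open import Data.List.Relation.Unary.Any using (here; there)
open import Data.List.Relation.Unary.Unique.Propositional using (Unique)
open import Data.List.Membership.Propositional using (_∈_)
import Data.List.Membership.DecPropositional as DecMembership
open import Data.Product using (∃; ∃₂; _,_; proj₁; proj₂)
open import Data.Sum using (inj₁; inj₂)
open import Data.Empty using (⊥-elim)
open import Function using (_∘_)
open import Function.Bundles using (Equivalence)
open import Relation.Nullary using (Dec; yes; no; does)
open import Relation.Nullary.Decidable using (dec-true; dec-false; toWitness; isYes≗does)
open import Relation.Binary.PropositionalEquality

open import Algebra.Properties.Semiring.Sum +-*-semiring
  using (sum; sum-cong-≗; ∑-comm; ∑-distrib-+; *-distribˡ-sum)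

2mn≤m²+n²-ordered : ∀ {m n} → m ≤ n → 2 * (m * n) ≤ m * m + n * n
2mn≤m²+n²-ordered {m} m≤n with m≤n⇒∃[o]m+o≡n m≤n
... | k , refl = subst (2 * (m * (m + k)) ≤_) (expand m k) (m≤m+n _ (k * k))
  where
  expand : ∀ m k → 2 * (m * (m + k)) + k * k ≡ m * m + (m + k) * (m + k)
  expand = solve-∀

2mn≤m²+n² : ∀ m n → 2 * (m * n) ≤ m * m + n * n
2mn≤m²+n² m n with ≤-total m n
... | inj₁ m≤n = 2mn≤m²+n²-ordered m≤n
... | inj₂ n≤m =
  subst₂ _≤_ (cong (2 *_) (*-comm n m)) (+-comm (n * n) (m * m)) (2mn≤m²+n²-ordered n≤m)

sum-mono-≤ : ∀ {k} {f g : Fin k → ℕ} → (∀ a → f a ≤ g a) → sum f ≤ sum g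
sum-mono-≤ {zero}  f≤g = z≤n
sum-mono-≤ {suc k} f≤g = +-mono-≤ (f≤g zero) (sum-mono-≤ (f≤g ∘ suc))

sum-mono-< : ∀ {k} .⦃ _ : NonZero k ⦄ {f g : Fin k → ℕ} → (∀ a → f a < g a) → sum f < sum g
sum-mono-< {suc k} f<g = +-mono-<-≤ (f<g zero) (sum-mono-≤ (<⇒≤ ∘ f<g ∘ suc))

sum-≤⇒∃ : ∀ {k} .⦃ _ : NonZero k ⦄ (f g : Fin k → ℕ) → sum f ≤ sum g → ∃ λ a → f a ≤ g a
sum-≤⇒∃ {k} f g ∑f≤∑g =
  let a , g≮f = Fin.¬∀⟶∃¬ k (λ a → g a < f a) (λ a → g a <? f a) (λ g<f → <⇒≱ (sum-mono-< g<f) ∑f≤∑g)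
  in a , ≮⇒≥ g≮f

sum-const : ∀ k c → sum {k} (λ _ → c) ≡ k * c
sum-const zero    c = refl
sum-const (suc k) c = cong (c +_) (sum-const k c)

sum-zero : ∀ {k} {f : Fin k → ℕ} → (∀ a → f a ≡ 0) → sum f ≡ 0
sum-zero {k} f≡0 = trans (sum-cong-≗ f≡0) (trans (sum-const k 0) (*-zeroʳ k))

sum-supported : ∀ {k} (f : Fin k → ℕ) x → (∀ a → a ≢ x → f a ≡ 0) → sum f ≡ f x
sum-supported f zero    f≡0 =
  trans (cong (f zero +_) (sum-zero λ a → f≡0 (suc a) λ ())) (+-identityʳ (f zero))
sum-supported f (suc x) f≡0 =
  trans (cong (_+ sum (f ∘ suc)) (f≡0 zero λ ()))
        (sum-supported (f ∘ suc) x λ a a≢x → f≡0 (suc a) (a≢x ∘ Fin.suc-injective))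

module VectorSums (N : ℕ) where

  ∑ⱽ : ∀ {m} → (Vec (Fin N) m → ℕ) → ℕ
  ∑ⱽ {zero}  f = f []
  ∑ⱽ {suc m} f = sum λ a → ∑ⱽ λ w → f (a ∷ w)

  ∑ⱽ-cong : ∀ {m} {f g : Vec (Fin N) m → ℕ} → (∀ v → f v ≡ g v) → ∑ⱽ f ≡ ∑ⱽ g
  ∑ⱽ-cong {zero}  f≗g = f≗g []
  ∑ⱽ-cong {suc m} f≗g = sum-cong-≗ {N} λ a → ∑ⱽ-cong (f≗g ∘ (a ∷_))

  ∑ⱽ-mono-≤ : ∀ {m} {f g : Vec (Fin N) m → ℕ} → (∀ v → f v ≤ g v) → ∑ⱽ f ≤ ∑ⱽ g
  ∑ⱽ-mono-≤ {zero}  f≤g = f≤g []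
  ∑ⱽ-mono-≤ {suc m} f≤g = sum-mono-≤ λ a → ∑ⱽ-mono-≤ (f≤g ∘ (a ∷_))

  ∑ⱽ-distrib-+ : ∀ {m} (f g : Vec (Fin N) m → ℕ) → ∑ⱽ (λ v → f v + g v) ≡ ∑ⱽ f + ∑ⱽ g
  ∑ⱽ-distrib-+ {zero}  f g = refl
  ∑ⱽ-distrib-+ {suc m} f g =
    trans (sum-cong-≗ {N} λ a → ∑ⱽ-distrib-+ (f ∘ (a ∷_)) (g ∘ (a ∷_))) (∑-distrib-+ {N} _ _)

  *-distribˡ-∑ⱽ : ∀ {m} c (f : Vec (Fin N) m → ℕ) → c * ∑ⱽ f ≡ ∑ⱽ (λ v → c * f v)
  *-distribˡ-∑ⱽ {zero}  c f = refl
  *-distribˡ-∑ⱽ {suc m} c f =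
    trans (*-distribˡ-sum {N} c _) (sum-cong-≗ {N} λ a → *-distribˡ-∑ⱽ c (f ∘ (a ∷_)))

  ∑ⱽ-const : ∀ m c → ∑ⱽ {m} (λ _ → c) ≡ N ^ m * c
  ∑ⱽ-const zero    c = sym (*-identityˡ c)
  ∑ⱽ-const (suc m) c = begin
    sum {N} (λ _ → ∑ⱽ {m} λ _ → c)  ≡⟨ sum-cong-≗ {N} (λ _ → ∑ⱽ-const m c) ⟩
    sum {N} (λ _ → N ^ m * c)       ≡⟨ sum-const N _ ⟩
    N * (N ^ m * c)                 ≡⟨ *-assoc N (N ^ m) c ⟨
    N ^ suc m * c                   ∎
    where open ≡-Reasoning

  ∑ⱽ-zero : ∀ {m} {f : Vec (Fin N) m → ℕ} → (∀ v → f v ≡ 0) → ∑ⱽ f ≡ 0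
  ∑ⱽ-zero {m} f≡0 = trans (∑ⱽ-cong f≡0) (trans (∑ⱽ-const m 0) (*-zeroʳ (N ^ m)))

  ∑ⱽ-supported : ∀ {m} (f : Vec (Fin N) m → ℕ) x → (∀ v → v ≢ x → f v ≡ 0) → ∑ⱽ f ≡ f x
  ∑ⱽ-supported f []       f≡0 = refl
  ∑ⱽ-supported f (a ∷ xs) f≡0 =
    trans (sum-supported {N} _ a λ b b≢a → ∑ⱽ-zero λ w → f≡0 (b ∷ w) (b≢a ∘ Vec.∷-injectiveˡ))
          (∑ⱽ-supported (f ∘ (a ∷_)) xs λ w w≢xs → f≡0 (a ∷ w) (w≢xs ∘ Vec.∷-injectiveʳ))

  sum-∑ⱽ-comm : ∀ {m} (F : Fin N → Vec (Fin N) m → ℕ) →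
    sum (λ a → ∑ⱽ (F a)) ≡ ∑ⱽ (λ v → sum λ a → F a v)
  sum-∑ⱽ-comm {zero}  F = refl
  sum-∑ⱽ-comm {suc m} F =
    trans (∑-comm {N} {N} λ a b → ∑ⱽ λ w → F a (b ∷ w))
          (sum-cong-≗ {N} λ b → sum-∑ⱽ-comm λ a w → F a (b ∷ w))

  ∑ⱽ-comm : ∀ {m n} (F : Vec (Fin N) m → Vec (Fin N) n → ℕ) →
    ∑ⱽ (λ u → ∑ⱽ (F u)) ≡ ∑ⱽ (λ v → ∑ⱽ λ u → F u v)
  ∑ⱽ-comm {zero}  F = refl
  ∑ⱽ-comm {suc m} F =
    trans (sum-cong-≗ {N} λ a → ∑ⱽ-comm (F ∘ (a ∷_))) (sum-∑ⱽ-comm λ a v → ∑ⱽ λ w → F (a ∷ w) v)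

  ∑ⱽ-++ : ∀ t {r} (f : Vec (Fin N) (t + r) → ℕ) →
    ∑ⱽ f ≡ ∑ⱽ {t} (λ u → ∑ⱽ {r} λ v → f (u ++ v))
  ∑ⱽ-++ zero    f = refl
  ∑ⱽ-++ (suc t) f = sum-cong-≗ {N} λ a → ∑ⱽ-++ t (f ∘ (a ∷_))

  ∑ⱽ-≤⇒∃ : ∀ .⦃ _ : NonZero N ⦄ {m} (f g : Vec (Fin N) m → ℕ) →
    ∑ⱽ f ≤ ∑ⱽ g → ∃ λ v → f v ≤ g v
  ∑ⱽ-≤⇒∃ {zero}  f g f≤g   = [] , f≤g
  ∑ⱽ-≤⇒∃ {suc m} f g ∑f≤∑g =
    let a , ∑fₐ≤∑gₐ = sum-≤⇒∃ {N} _ _ ∑f≤∑g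
        w , f≤g     = ∑ⱽ-≤⇒∃ (f ∘ (a ∷_)) (g ∘ (a ∷_)) ∑fₐ≤∑gₐ
    in a ∷ w , f≤g

  ∑ⱽ-*-∑ⱽ : ∀ {m n} (f : Vec (Fin N) m → ℕ) (g : Vec (Fin N) n → ℕ) →
    ∑ⱽ f * ∑ⱽ g ≡ ∑ⱽ (λ u → ∑ⱽ λ v → f u * g v)
  ∑ⱽ-*-∑ⱽ f g = begin
    ∑ⱽ f * ∑ⱽ g                     ≡⟨ *-comm (∑ⱽ f) (∑ⱽ g) ⟩
    ∑ⱽ g * ∑ⱽ f                     ≡⟨ *-distribˡ-∑ⱽ (∑ⱽ g) f ⟩
    ∑ⱽ (λ u → ∑ⱽ g * f u)           ≡⟨ ∑ⱽ-cong (λ u → *-comm (∑ⱽ g) (f u)) ⟩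
    ∑ⱽ (λ u → f u * ∑ⱽ g)           ≡⟨ ∑ⱽ-cong (λ u → *-distribˡ-∑ⱽ (f u) g) ⟩
    ∑ⱽ (λ u → ∑ⱽ λ v → f u * g v)   ∎
    where open ≡-Reasoning

  ∑ⱽ-Cauchy-Schwarz : ∀ {m} (s : Vec (Fin N) m → ℕ) → ∑ⱽ s * ∑ⱽ s ≤ N ^ m * ∑ⱽ (λ v → s v * s v)
  ∑ⱽ-Cauchy-Schwarz {m} s = *-cancelˡ-≤ 2 (begin
    2 * (∑ⱽ s * ∑ⱽ s)
      ≡⟨ cong (2 *_) (∑ⱽ-*-∑ⱽ s s) ⟩
    2 * ∑ⱽ (λ u → ∑ⱽ λ v → s u * s v)
      ≡⟨ *-distribˡ-∑ⱽ 2 (λ u → ∑ⱽ λ v → s u * s v) ⟩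
    ∑ⱽ (λ u → 2 * ∑ⱽ λ v → s u * s v)
      ≡⟨ ∑ⱽ-cong (λ u → *-distribˡ-∑ⱽ 2 λ v → s u * s v) ⟩
    ∑ⱽ (λ u → ∑ⱽ λ v → 2 * (s u * s v))
      ≤⟨ ∑ⱽ-mono-≤ (λ u → ∑ⱽ-mono-≤ λ v → 2mn≤m²+n² (s u) (s v)) ⟩
    ∑ⱽ (λ u → ∑ⱽ λ v → sq u + sq v)
      ≡⟨ ∑ⱽ-cong (λ u → ∑ⱽ-distrib-+ (λ _ → sq u) sq) ⟩
    ∑ⱽ (λ u → ∑ⱽ {m} (λ _ → sq u) + Q)
      ≡⟨ ∑ⱽ-cong (λ u → cong (_+ Q) (∑ⱽ-const m (sq u))) ⟩
    ∑ⱽ (λ u → N ^ m * sq u + Q)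
      ≡⟨ ∑ⱽ-distrib-+ (λ u → N ^ m * sq u) (λ _ → Q) ⟩
    ∑ⱽ (λ u → N ^ m * sq u) + ∑ⱽ {m} (λ _ → Q)
      ≡⟨ cong₂ _+_ (*-distribˡ-∑ⱽ (N ^ m) sq) (sym (∑ⱽ-const m Q)) ⟨
    N ^ m * Q + N ^ m * Q
      ≡⟨ cong (N ^ m * Q +_) (+-identityʳ _) ⟨
    2 * (N ^ m * Q)
      ∎)
    where
    open ≤-Reasoning
    sq : Vec (Fin N) m → ℕ
    sq v = s v * s v
    Q = ∑ⱽ sq

  _≟ⱽ_ : ∀ {m} (u v : Vec (Fin N) m) → Dec (u ≡ v)
  _≟ⱽ_ = Vec.≡-dec Fin._≟_

  puncture : ∀ {m} → (Vec (Fin N) m → ℕ) → Vec (Fin N) m → Vec (Fin N) m → ℕ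
  puncture f x v = if does (v ≟ⱽ x) then 0 else f v

  ∑ⱽ-puncture : ∀ {m} (f : Vec (Fin N) m → ℕ) x → ∑ⱽ f ≡ f x + ∑ⱽ (puncture f x)
  ∑ⱽ-puncture {m} f x = begin
    ∑ⱽ f                                ≡⟨ ∑ⱽ-cong split ⟩
    ∑ⱽ (λ v → at-x v + puncture f x v)  ≡⟨ ∑ⱽ-distrib-+ at-x (puncture f x) ⟩
    ∑ⱽ at-x + ∑ⱽ (puncture f x)         ≡⟨ cong (_+ ∑ⱽ (puncture f x)) (∑ⱽ-supported at-x x at-x-supported) ⟩
    at-x x + ∑ⱽ (puncture f x)          ≡⟨ cong (_+ ∑ⱽ (puncture f x)) at-x-x ⟩
    f x + ∑ⱽ (puncture f x)             ∎
    where
    open ≡-Reasoning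
    at-x : Vec (Fin N) m → ℕ
    at-x v = if does (v ≟ⱽ x) then f v else 0
    split : ∀ v → f v ≡ at-x v + puncture f x v
    split v with does (v ≟ⱽ x)
    ... | true  = sym (+-identityʳ (f v))
    ... | false = refl
    at-x-supported : ∀ v → v ≢ x → at-x v ≡ 0
    at-x-supported v v≢x = cong (λ b → if b then f v else 0) (dec-false (v ≟ⱽ x) v≢x)
    at-x-x : at-x x ≡ f x
    at-x-x = cong (λ b → if b then f x else 0) (dec-true (x ≟ⱽ x) refl)

  ∑ⱽ-puncture-≤⇒∃ : ∀ .⦃ _ : NonZero N ⦄ {m} (h : Vec (Fin N) m → Vec (Fin N) m → ℕ) c X →
    0 < c → N ^ m * (N ^ m * c) ≤ X * ∑ⱽ (λ u → ∑ⱽ (puncture (h u) u)) →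
    ∃₂ λ u v → v ≢ u × c ≤ X * h u v
  ∑ⱽ-puncture-≤⇒∃ {m} h c X 0<c hyp =
    let u , ∑c≤∑Xhᵤ = ∑ⱽ-≤⇒∃ (λ u → ∑ⱽ {m} λ _ → c) (λ u → ∑ⱽ (Xh u)) (subst₂ _≤_ lhs rhs hyp)
        v , c≤Xhᵤᵥ   = ∑ⱽ-≤⇒∃ (λ _ → c) (Xh u) ∑c≤∑Xhᵤ
    in off-diagonal u v c≤Xhᵤᵥ
    where
    Xh : Vec (Fin N) m → Vec (Fin N) m → ℕ
    Xh u v = X * puncture (h u) u v
    lhs : N ^ m * (N ^ m * c) ≡ ∑ⱽ {m} (λ u → ∑ⱽ {m} λ _ → c)
    lhs = sym (trans (∑ⱽ-cong {m} λ _ → ∑ⱽ-const m c) (∑ⱽ-const m (N ^ m * c)))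
    rhs : X * ∑ⱽ (λ u → ∑ⱽ (puncture (h u) u)) ≡ ∑ⱽ (λ u → ∑ⱽ (Xh u))
    rhs = trans (*-distribˡ-∑ⱽ X (λ u → ∑ⱽ (puncture (h u) u)))
                (∑ⱽ-cong λ u → *-distribˡ-∑ⱽ X (puncture (h u) u))
    off-diagonal : ∀ u v → c ≤ Xh u v → ∃₂ λ u v → v ≢ u × c ≤ X * h u v
    off-diagonal u v c≤Xhᵤᵥ with v ≟ⱽ u
    ... | yes _   = ⊥-elim (<⇒≱ 0<c (subst (c ≤_) (*-zeroʳ X) c≤Xhᵤᵥ))
    ... | no  v≢u = u , v , v≢u , c≤Xhᵤᵥ

χ : Bool → ℕ
χ true  = 1
χ false = 0

χ-∧ : ∀ a b → χ (a ∧ b) ≡ χ a * χ b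
χ-∧ true  b = sym (+-identityʳ (χ b))
χ-∧ false b = refl

χ-positive : ∀ c b → 0 < c * χ b → T b
χ-positive c true  _     = _
χ-positive c false 0<c*0 = ⊥-elim (<-irrefl (sym (*-zeroʳ c)) 0<c*0)

split-≤ : ∀ {t k m} → t + k ≤ m → ∃ λ r → t + r ≡ m × k ≤ r
split-≤ {t} {k} t+k≤m with m≤n⇒∃[o]m+o≡n t+k≤m
... | o , t+k+o≡m = k + o , trans (sym (+-assoc t k o)) t+k+o≡m , m≤m+n k o

-- A block of length e + 1 has N^(e+1) ≥ 2^(e+1) points, enough for the pair step at density
-- 2^-e, which leaves density 2^-(2e+1) on the remaining coordinates.
blockLength : ℕ → ℕ → ℕ
blockLength zero    e = 0
blockLength (suc d) e = suc e + blockLength d (suc (e + e))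

blockLength-+ : ∀ d e → blockLength d e + suc e ≡ 2 ^ d * suc e
blockLength-+ zero    e = sym (*-identityˡ (suc e))
blockLength-+ (suc d) e = begin
  suc e + blockLength d e′ + suc e  ≡⟨ regroup e (blockLength d e′) ⟩
  blockLength d e′ + suc e′         ≡⟨ blockLength-+ d e′ ⟩
  2 ^ d * suc e′                    ≡⟨ double (2 ^ d) e ⟩
  2 ^ suc d * suc e                 ∎
  where
  open ≡-Reasoning
  e′ = suc (e + e)
  regroup : ∀ e x → suc e + x + suc e ≡ x + suc (suc (e + e))
  regroup = solve-∀
  double : ∀ y e → y * suc (suc (e + e)) ≡ 2 * y * suc e
  double = solve-∀

-- In the pair step M = N^t, R = N^r, E = 2^e, A = |P| and G sums the common fibre sizes over
-- pairs u ≠ v. Since A ≥ 2R, the diagonal term R·A is at most half of A², whence A² ≤ 2RG.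
off-diagonal-bound : ∀ {A E G M R} → 0 < R → 0 < E →
  M * R ≤ E * A → 2 * E ≤ M → A * A ≤ R * (A + G) → M * (M * R) ≤ 2 * (E * E) * G
off-diagonal-bound {A} {E} {G} {M} {R} 0<R 0<E MR≤EA 2E≤M A²≤R[A+G] =
  *-cancelˡ-≤ R ⦃ >-nonZero 0<R ⦄ (begin
    R * (M * (M * R))       ≡⟨ square₁ R M ⟩
    (M * R) * (M * R)       ≤⟨ *-mono-≤ MR≤EA MR≤EA ⟩
    (E * A) * (E * A)       ≡⟨ square₂ E A ⟩
    E * E * (A * A)         ≤⟨ *-monoʳ-≤ (E * E) A²≤2RG ⟩
    E * E * (2 * R * G)     ≡⟨ square₃ E R G ⟩
    R * (2 * (E * E) * G)   ∎)
  where
  open ≤-Reasoning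
  square₁ : ∀ R M → R * (M * (M * R)) ≡ (M * R) * (M * R)
  square₁ = solve-∀
  square₂ : ∀ E A → (E * A) * (E * A) ≡ E * E * (A * A)
  square₂ = solve-∀
  square₃ : ∀ E R G → E * E * (2 * R * G) ≡ R * (2 * (E * E) * G)
  square₃ = solve-∀
  2R≤A : 2 * R ≤ A
  2R≤A = *-cancelˡ-≤ E ⦃ >-nonZero 0<E ⦄ (begin
    E * (2 * R)  ≡⟨ *-assoc E 2 R ⟨
    E * 2 * R    ≡⟨ cong (_* R) (*-comm E 2) ⟩
    2 * E * R    ≤⟨ *-monoˡ-≤ R 2E≤M ⟩
    M * R        ≤⟨ MR≤EA ⟩
    E * A        ∎)
  A²≤2RG : A * A ≤ 2 * R * G
  A²≤2RG = +-cancelˡ-≤ (A * A) (A * A) (2 * R * G) (begin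
    A * A + A * A             ≤⟨ +-mono-≤ A²≤R[A+G] A²≤R[A+G] ⟩
    R * (A + G) + R * (A + G) ≡⟨ double R A G ⟩
    2 * R * A + 2 * R * G     ≤⟨ +-monoˡ-≤ (2 * R * G) (*-monoˡ-≤ A 2R≤A) ⟩
    A * A + 2 * R * G         ∎)
    where
    double : ∀ R A G → R * (A + G) + R * (A + G) ≡ 2 * R * A + 2 * R * G
    double = solve-∀

module DensityIncrement (N : ℕ) where
  open VectorSums N

  count : ∀ {m} → (Vec (Fin N) m → Bool) → ℕ
  count P = ∑ⱽ (χ ∘ P)

  Dense : ∀ {m} → ℕ → (Vec (Fin N) m → Bool) → Set
  Dense {m} e P = N ^ m ≤ 2 ^ e * count P

  Dense⇒∃ : ∀ .⦃ _ : NonZero N ⦄ {m} e (P : Vec (Fin N) m → Bool) → Dense e P → ∃ λ v → T (P v)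
  Dense⇒∃ {m} e P dense =
    let v , 1≤2ᵉχ = ∑ⱽ-≤⇒∃ (λ _ → 1) (λ v → 2 ^ e * χ (P v))
                      (subst₂ _≤_ ones (*-distribˡ-∑ⱽ (2 ^ e) (χ ∘ P)) dense)
    in v , χ-positive (2 ^ e) (P v) 1≤2ᵉχ
    where
    ones : N ^ m ≡ ∑ⱽ {m} λ _ → 1
    ones = sym (trans (∑ⱽ-const m 1) (*-identityʳ (N ^ m)))

  fibreSize : ∀ t {r} → (Vec (Fin N) (t + r) → Bool) → Vec (Fin N) r → ℕ
  fibreSize t P y = ∑ⱽ {t} λ u → χ (P (u ++ y))

  commonFibreSize : ∀ t {r} → (Vec (Fin N) (t + r) → Bool) → Vec (Fin N) t → Vec (Fin N) t → ℕ
  commonFibreSize t {r} P u v = count {r} λ y → P (u ++ y) ∧ P (v ++ y)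

  count≡∑fibreSize : ∀ t {r} (P : Vec (Fin N) (t + r) → Bool) → count P ≡ ∑ⱽ (fibreSize t P)
  count≡∑fibreSize t {r} P = trans (∑ⱽ-++ t (χ ∘ P)) (∑ⱽ-comm {t} {r} λ u y → χ (P (u ++ y)))

  ∑commonFibreSize≡∑fibreSize² : ∀ t {r} (P : Vec (Fin N) (t + r) → Bool) →
    ∑ⱽ (λ u → ∑ⱽ (commonFibreSize t P u)) ≡ ∑ⱽ (λ y → fibreSize t P y * fibreSize t P y)
  ∑commonFibreSize≡∑fibreSize² t {r} P = begin
    ∑ⱽ (λ u → ∑ⱽ (commonFibreSize t P u))
      ≡⟨ ∑ⱽ-cong {t} (λ u → ∑ⱽ-cong {t} λ v → ∑ⱽ-cong {r} λ y → χ-∧ (P (u ++ y)) (P (v ++ y))) ⟩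
    ∑ⱽ (λ u → ∑ⱽ λ v → ∑ⱽ λ y → Q u y * Q v y)
      ≡⟨ ∑ⱽ-cong (λ u → ∑ⱽ-comm λ v y → Q u y * Q v y) ⟩
    ∑ⱽ (λ u → ∑ⱽ λ y → ∑ⱽ λ v → Q u y * Q v y)
      ≡⟨ ∑ⱽ-comm (λ u y → ∑ⱽ λ v → Q u y * Q v y) ⟩
    ∑ⱽ (λ y → ∑ⱽ λ u → ∑ⱽ λ v → Q u y * Q v y)
      ≡⟨ ∑ⱽ-cong (λ y → ∑ⱽ-*-∑ⱽ (λ u → Q u y) (λ v → Q v y)) ⟨
    ∑ⱽ (λ y → fibreSize t P y * fibreSize t P y)
      ∎
    where
    open ≡-Reasoning
    Q : Vec (Fin N) t → Vec (Fin N) r → ℕ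
    Q u y = χ (P (u ++ y))

  ∑commonFibreSize-diagonal : ∀ t {r} (P : Vec (Fin N) (t + r) → Bool) →
    ∑ⱽ (λ u → commonFibreSize t P u u) ≡ count P
  ∑commonFibreSize-diagonal t {r} P =
    trans (∑ⱽ-cong {t} λ u → ∑ⱽ-cong {r} λ y → cong χ (∧-idem (P (u ++ y)))) (sym (∑ⱽ-++ t (χ ∘ P)))

  dense-pair : ∀ .⦃ _ : NonZero N ⦄ t {r} e (P : Vec (Fin N) (t + r) → Bool) →
    2 ^ suc e ≤ N ^ t → Dense e P → ∃₂ λ u v → v ≢ u × Dense (suc (e + e)) (λ y → P (u ++ y) ∧ P (v ++ y))
  dense-pair t {r} e P 2E≤M dense = ∑ⱽ-puncture-≤⇒∃ g (N ^ r) (2 ^ suc (e + e)) (m^n>0 N r) bound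
    where
    g = commonFibreSize t P
    A = count P
    G = ∑ⱽ λ u → ∑ⱽ (puncture (g u) u)

    ∑g≡A+G : ∑ⱽ (λ u → ∑ⱽ (g u)) ≡ A + G
    ∑g≡A+G = begin
      ∑ⱽ (λ u → ∑ⱽ (g u))                        ≡⟨ ∑ⱽ-cong (λ u → ∑ⱽ-puncture (g u) u) ⟩
      ∑ⱽ (λ u → g u u + ∑ⱽ (puncture (g u) u))   ≡⟨ ∑ⱽ-distrib-+ (λ u → g u u) (λ u → ∑ⱽ (puncture (g u) u)) ⟩
      ∑ⱽ (λ u → g u u) + G                       ≡⟨ cong (_+ G) (∑commonFibreSize-diagonal t P) ⟩
      A + G                                      ∎
      where open ≡-Reasoning

    A²≤R[A+G] : A * A ≤ N ^ r * (A + G)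
    A²≤R[A+G] = begin
      A * A                                       ≡⟨ cong₂ _*_ (count≡∑fibreSize t P) (count≡∑fibreSize t P) ⟩
      ∑ⱽ (fibreSize t P) * ∑ⱽ (fibreSize t P)     ≤⟨ ∑ⱽ-Cauchy-Schwarz (fibreSize t P) ⟩
      N ^ r * ∑ⱽ (λ y → fibreSize t P y * fibreSize t P y)
        ≡⟨ cong (N ^ r *_) (trans (sym (∑commonFibreSize≡∑fibreSize² t P)) ∑g≡A+G) ⟩
      N ^ r * (A + G)                             ∎
      where open ≤-Reasoning

    MR≤EA : N ^ t * N ^ r ≤ 2 ^ e * A
    MR≤EA = subst (_≤ 2 ^ e * A) (^-distribˡ-+-* N t r) dense

    bound : N ^ t * (N ^ t * N ^ r) ≤ 2 ^ suc (e + e) * G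
    bound = subst (λ x → N ^ t * (N ^ t * N ^ r) ≤ 2 * x * G) (sym (^-distribˡ-+-* 2 e e))
              (off-diagonal-bound (m^n>0 N r) (m^n>0 2 e) MR≤EA 2E≤M A²≤R[A+G])

  data BlockCube : ℕ → ℕ → Set where
    point  : ∀ {m} → Vec (Fin N) m → BlockCube 0 m
    extend : ∀ {d t r} (u v : Vec (Fin N) t) → v ≢ u → BlockCube d r → BlockCube (suc d) (t + r)

  vertex : ∀ {d m} → BlockCube d m → (Fin d → Bool) → Vec (Fin N) m
  vertex (point y)        σ = y
  vertex (extend u v _ C) σ = (if σ zero then v else u) ++ vertex C (σ ∘ suc)

  dense⇒blockCube : ∀ .⦃ _ : NonZero N ⦄ → 2 ≤ N → ∀ d e {m} → blockLength d e ≤ m →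
    (P : Vec (Fin N) m → Bool) → Dense e P → Σ (BlockCube d m) λ C → ∀ σ → T (P (vertex C σ))
  dense⇒blockCube 2≤N zero e _ P dense =
    let y , Py = Dense⇒∃ e P dense in point y , λ _ → Py
  dense⇒blockCube 2≤N (suc d) e len P dense with split-≤ {suc e} len
  ... | r , refl , len′ =
    let u , v , v≢u , dense′ = dense-pair (suc e) {r} e P (^-monoˡ-≤ (suc e) 2≤N) dense
        C , inC = dense⇒blockCube 2≤N d (suc (e + e)) len′ (λ y → P (u ++ y) ∧ P (v ++ y)) dense′
    in extend u v v≢u C , λ σ → pick (σ zero) (inC (σ ∘ suc))
    where
    pick : ∀ {u v : Vec (Fin N) (suc e)} b {w} →
      T (P (u ++ w) ∧ P (v ++ w)) → T (P ((if b then v else u) ++ w))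
    pick true  = proj₂ ∘ Equivalence.to T-∧
    pick false = proj₁ ∘ Equivalence.to T-∧

↑-cases : ∀ {t r} {P : Fin (t + r) → Set} → (∀ k → P (k ↑ˡ r)) → (∀ j → P (t ↑ʳ j)) → ∀ i → P i
↑-cases {t} {r} {P} left right i = subst P (Fin.join-splitAt t r i) (on-join (splitAt t i))
  where
  on-join : ∀ s → P (join t r s)
  on-join (inj₁ k) = left k
  on-join (inj₂ j) = right j

lookup-≢ : ∀ {N n} {u v : Vec (Fin N) n} → u ≢ v → ∃ λ k → lookup u k ≢ lookup v k
lookup-≢ {n = n} {u} {v} u≢v =
  Fin.¬∀⟶∃¬ n _ (λ k → lookup u k Fin.≟ lookup v k) λ u≗v → u≢v (begin
    u                    ≡⟨ Vec.tabulate∘lookup u ⟨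
    tabulate (lookup u)  ≡⟨ Vec.tabulate-cong u≗v ⟩
    tabulate (lookup v)  ≡⟨ Vec.tabulate∘lookup v ⟩
    v                    ∎)
  where open ≡-Reasoning

sumFinℤ-zero : ∀ d {f : Fin d → ℤ} → (∀ j → f j ≡ 0ℤ) → sumFinℤ d f ≡ 0ℤ
sumFinℤ-zero zero    f≡0 = refl
sumFinℤ-zero (suc d) f≡0 = cong₂ ℤ._+_ (f≡0 zero) (sumFinℤ-zero d (f≡0 ∘ suc))

apply-++ˡ : ∀ {t r d} (B : Mat t d) (B′ : Mat r d) w k →
  apply (B Vector.++ B′) w (k ↑ˡ r) ≡ apply B w k
apply-++ˡ {d = d} B B′ w k = cong (λ row → sumFinℤ d λ j → row j ℤ.* w j) (Vector.lookup-++ˡ B B′ k)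

apply-++ʳ : ∀ {t r d} (B : Mat t d) (B′ : Mat r d) w i →
  apply (B Vector.++ B′) w (t ↑ʳ i) ≡ apply B′ w i
apply-++ʳ {d = d} B B′ w i = cong (λ row → sumFinℤ d λ j → row j ℤ.* w j) (Vector.lookup-++ʳ B B′ i)

interpolate : ∀ x y b → x ℤ.+ (y ℤ.- x) ℤ.* bit b ≡ (if b then y else x)
interpolate x y true  = at-one x y
  where
  at-one : ∀ x y → x ℤ.+ (y ℤ.- x) ℤ.* ℤ.+ 1 ≡ y
  at-one = ℤ-Solver.solve-∀
interpolate x y false = at-zero x y
  where
  at-zero : ∀ x y → x ℤ.+ (y ℤ.- x) ℤ.* ℤ.+ 0 ≡ x
  at-zero = ℤ-Solver.solve-∀

embed : ∀ {N n} → Vec (Fin N) n → Pt n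
embed s i = ℤ.+ toℕ (lookup s i)

module CubeGeometry (N : ℕ) where
  open DensityIncrement N

  firstBlock : ∀ {t d} (u v : Vec (Fin N) t) → Mat t (suc d)
  firstBlock u v k = (embed v k ℤ.- embed u k) Vector.∷ λ _ → 0ℤ

  shift : ∀ {r d} → Mat r d → Mat r (suc d)
  shift B i = 0ℤ Vector.∷ B i

  origin : ∀ {d m} → BlockCube d m → Pt m
  origin (point y)        = embed y
  origin (extend u v _ C) = embed u Vector.++ origin C

  edges : ∀ {d m} → BlockCube d m → Mat m d
  edges (point y)        i ()
  edges (extend u v _ C) = firstBlock u v Vector.++ shift (edges C)

  apply-edges-↑ˡ : ∀ {d t r} (u v : Vec (Fin N) t) v≢u (C : BlockCube d r) w k →
    apply (edges (extend u v v≢u C)) w (k ↑ˡ r) ≡ (embed v k ℤ.- embed u k) ℤ.* w zero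
  apply-edges-↑ˡ {d} u v _ C w k = begin
    apply (firstBlock u v Vector.++ shift (edges C)) w (k ↑ˡ _)
      ≡⟨ apply-++ˡ (firstBlock u v) (shift (edges C)) w k ⟩
    δ ℤ.* w zero ℤ.+ sumFinℤ d (λ j → 0ℤ ℤ.* w (suc j))
      ≡⟨ cong (ℤ._+_ (δ ℤ.* w zero)) (sumFinℤ-zero d λ _ → refl) ⟩
    δ ℤ.* w zero ℤ.+ 0ℤ
      ≡⟨ ℤₚ.+-identityʳ (δ ℤ.* w zero) ⟩
    δ ℤ.* w zero
      ∎
    where
    open ≡-Reasoning
    δ = embed v k ℤ.- embed u k

  apply-edges-↑ʳ : ∀ {d t r} (u v : Vec (Fin N) t) v≢u (C : BlockCube d r) w i →
    apply (edges (extend u v v≢u C)) w (t ↑ʳ i) ≡ apply (edges C) (w ∘ suc) i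
  apply-edges-↑ʳ u v _ C w i =
    trans (apply-++ʳ (firstBlock u v) (shift (edges C)) w i) (ℤₚ.+-identityˡ _)

  origin+edges≡vertex : ∀ {d m} (C : BlockCube d m) σ i →
    origin C i ℤ.+ apply (edges C) (bit ∘ σ) i ≡ embed (vertex C σ) i
  origin+edges≡vertex (point y) σ i = ℤₚ.+-identityʳ (embed y i)
  origin+edges≡vertex {m = m} (extend {t = t} {r} u v v≢u C) σ = ↑-cases first rest
    where
    open ≡-Reasoning
    u|v = if σ zero then v else u
    w = vertex C (σ ∘ suc)
    Goal : Fin m → Set
    Goal i = origin (extend u v v≢u C) i ℤ.+ apply (edges (extend u v v≢u C)) (bit ∘ σ) i
             ≡ embed (vertex (extend u v v≢u C) σ) i
    embed-if : ∀ b k → (if b then embed v k else embed u k) ≡ embed (if b then v else u) k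
    embed-if true  k = refl
    embed-if false k = refl
    first : ∀ k → Goal (k ↑ˡ r)
    first k = begin
      (embed u Vector.++ origin C) (k ↑ˡ r) ℤ.+ apply (edges (extend u v v≢u C)) (bit ∘ σ) (k ↑ˡ r)
        ≡⟨ cong₂ ℤ._+_ (Vector.lookup-++ˡ (embed u) (origin C) k) (apply-edges-↑ˡ u v v≢u C (bit ∘ σ) k) ⟩
      embed u k ℤ.+ (embed v k ℤ.- embed u k) ℤ.* bit (σ zero)
        ≡⟨ interpolate (embed u k) (embed v k) (σ zero) ⟩
      (if σ zero then embed v k else embed u k)
        ≡⟨ embed-if (σ zero) k ⟩
      embed u|v k
        ≡⟨ cong (ℤ.+_ ∘ toℕ) (Vec.lookup-++ˡ u|v w k) ⟨
      embed (u|v ++ w) (k ↑ˡ r)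
        ∎
    rest : ∀ j → Goal (t ↑ʳ j)
    rest j = begin
      (embed u Vector.++ origin C) (t ↑ʳ j) ℤ.+ apply (edges (extend u v v≢u C)) (bit ∘ σ) (t ↑ʳ j)
        ≡⟨ cong₂ ℤ._+_ (Vector.lookup-++ʳ (embed u) (origin C) j) (apply-edges-↑ʳ u v v≢u C (bit ∘ σ) j) ⟩
      origin C j ℤ.+ apply (edges C) (bit ∘ σ ∘ suc) j
        ≡⟨ origin+edges≡vertex C (σ ∘ suc) j ⟩
      embed w j
        ≡⟨ cong (ℤ.+_ ∘ toℕ) (Vec.lookup-++ʳ u|v w j) ⟨
      embed (u|v ++ w) (t ↑ʳ j)
        ∎

  edges-injective : ∀ {d m} (C : BlockCube d m) → InjectiveMat (edges C)
  edges-injective (point y) _ _ _ ()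
  edges-injective (extend {r = r} u v v≢u C) w w′ Bw≡Bw′ zero =
    let k , vₖ≢uₖ = lookup-≢ v≢u
        δ = embed v k ℤ.- embed u k
        δ≢0 : δ ≢ 0ℤ
        δ≢0 = vₖ≢uₖ ∘ Fin.toℕ-injective ∘ ℤₚ.+-injective ∘ ℤₚ.i-j≡0⇒i≡j _ _
    in ℤₚ.*-cancelˡ-≡ δ (w zero) (w′ zero) ⦃ ≢-nonZero δ≢0 ⦄
         (trans (sym (apply-edges-↑ˡ u v v≢u C w k))
                (trans (Bw≡Bw′ (k ↑ˡ r)) (apply-edges-↑ˡ u v v≢u C w′ k)))
  edges-injective (extend {t = t} u v v≢u C) w w′ Bw≡Bw′ (suc j) =
    edges-injective C (w ∘ suc) (w′ ∘ suc)
      (λ i → trans (sym (apply-edges-↑ʳ u v v≢u C w i))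
                   (trans (Bw≡Bw′ (t ↑ʳ i)) (apply-edges-↑ʳ u v v≢u C w′ i)))
      j

InConv-resp-≗ : ∀ {N n} (S : GridSet N n) {x y : Pt n} → (∀ i → x i ≡ y i) → InConv S x → InConv S y
InConv-resp-≗ S x≗y (ws , len , nonneg , total , combo) =
  ws , len , nonneg , total , λ i → trans (combo i) (cong toℚ (x≗y i))

sumℚ-replicate-0 : ∀ k → sumℚ (replicate k 0ℚ) ≡ 0ℚ
sumℚ-replicate-0 zero    = refl
sumℚ-replicate-0 (suc k) = trans (ℚₚ.+-identityˡ _) (sumℚ-replicate-0 k)

sumℚ-zipWith-0 : ∀ {A : Set} (f : A → ℚ) (xs : List A) →
  sumℚ (zipWith (λ w s → w ℚ.* f s) (replicate (length xs) 0ℚ) xs) ≡ 0ℚ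
sumℚ-zipWith-0 f []       = refl
sumℚ-zipWith-0 f (x ∷ xs) = trans (cong₂ ℚ._+_ (ℚₚ.*-zeroˡ (f x)) (sumℚ-zipWith-0 f xs)) (ℚₚ.+-identityˡ 0ℚ)

-- Only the list matters for InConv; uniq just packages the tail as a GridSet.
∈⇒InConv : ∀ {N n} (xs : List (Vec (Fin N) n)) (uniq : Unique xs) {s} →
  s ∈ xs → InConv (gridSet xs uniq) (embed s)
∈⇒InConv (y ∷ ys) _ (here refl) =
  1ℚ ∷ replicate (length ys) 0ℚ ,
  cong suc (length-replicate (length ys)) ,
  ℚₚ.nonNegative⁻¹ 1ℚ ∷ replicate⁺ (length ys) ℚₚ.≤-refl ,
  trans (cong (1ℚ ℚ.+_) (sumℚ-replicate-0 (length ys))) (ℚₚ.+-identityʳ 1ℚ) ,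
  λ i → trans (cong₂ ℚ._+_ (ℚₚ.*-identityˡ (coordℚ y i)) (sumℚ-zipWith-0 (λ s → coordℚ s i) ys))
              (ℚₚ.+-identityʳ (coordℚ y i))
∈⇒InConv (y ∷ ys) (_ ∷ uniq) (there s∈ys) =
  let ws , len , nonneg , total , combo = ∈⇒InConv ys uniq s∈ys in
  0ℚ ∷ ws ,
  cong suc len ,
  ℚₚ.≤-refl ∷ nonneg ,
  trans (ℚₚ.+-identityˡ (sumℚ ws)) total ,
  λ i → trans (cong₂ ℚ._+_ (ℚₚ.*-zeroˡ (coordℚ y i)) (combo i)) (ℚₚ.+-identityˡ _)

n≤2^n : ∀ n → n ≤ 2 ^ n
n≤2^n zero    = z≤n
n≤2^n (suc n) = subst (suc n ≤_) (cong (2 ^ n +_) (sym (+-identityʳ (2 ^ n)))) (+-mono-≤ (m^n>0 2 n) (n≤2^n n))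

module GridSets (N : ℕ) {n : ℕ} where
  open VectorSums N
  open DensityIncrement N
  open CubeGeometry N
  open DecMembership (_≟ⱽ_ {n}) using (_∈?_)

  _∈ᵇ_ : Vec (Fin N) n → GridSet N n → Bool
  v ∈ᵇ S = does (v ∈? elems S)

  χ-∈?-∷ : ∀ {x} {xs : List (Vec (Fin N) n)} → All (x ≢_) xs → ∀ v →
    χ (does (v ∈? (x ∷ xs))) ≡ χ (does (v ≟ⱽ x)) + χ (does (v ∈? xs))
  χ-∈?-∷ {x} {xs} x∉xs v with v ≟ⱽ x
  ... | yes refl = cong (λ b → 1 + χ b) (sym (dec-false (v ∈? xs) (All¬⇒¬Any x∉xs)))
  ... | no  _    = refl

  count-≟ : ∀ x → count (λ v → does (v ≟ⱽ x)) ≡ 1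
  count-≟ x = trans (∑ⱽ-supported {n} _ x λ v v≢x → cong χ (dec-false (v ≟ⱽ x) v≢x))
                    (cong χ (dec-true (x ≟ⱽ x) refl))

  count-∈? : (xs : List (Vec (Fin N) n)) → Unique xs → count (λ v → does (v ∈? xs)) ≡ length xs
  count-∈? []       _             = ∑ⱽ-zero {n} λ _ → refl
  count-∈? (x ∷ xs) (x∉xs ∷ uniq) = begin
    count (λ v → does (v ∈? (x ∷ xs)))                            ≡⟨ ∑ⱽ-cong {n} (χ-∈?-∷ x∉xs) ⟩
    ∑ⱽ (λ v → χ (does (v ≟ⱽ x)) + χ (does (v ∈? xs)))             ≡⟨ ∑ⱽ-distrib-+ {n} _ _ ⟩
    count (λ v → does (v ≟ⱽ x)) + count (λ v → does (v ∈? xs))   ≡⟨ cong₂ _+_ (count-≟ x) (count-∈? xs uniq) ⟩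
    suc (length xs)                                               ∎
    where open ≡-Reasoning

  DensityAtLeast⇒Dense : ∀ {p q} (S : GridSet N n) → 1 ≤ p → DensityAtLeast S p q → Dense q (_∈ᵇ S)
  DensityAtLeast⇒Dense {p} {q} S 1≤p density = begin
    N ^ n                      ≤⟨ m≤n*m (N ^ n) p ⦃ >-nonZero 1≤p ⦄ ⟩
    p * N ^ n                  ≤⟨ density ⟩
    q * length (elems S)       ≤⟨ *-monoˡ-≤ (length (elems S)) (n≤2^n q) ⟩
    2 ^ q * length (elems S)   ≡⟨ cong (2 ^ q *_) (count-∈? (elems S) (unique S)) ⟨
    2 ^ q * count (_∈ᵇ S)      ∎
    where open ≤-Reasoning

  blockCube⇒HasCube : ∀ {d} (S : GridSet N n) (C : BlockCube d n) → (∀ σ → T (vertex C σ ∈ᵇ S)) → HasCube S d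
  blockCube⇒HasCube S C inS = edges C , origin C , edges-injective C , λ σ →
    let vertex∈S = toWitness (subst T (sym (isYes≗does (vertex C σ ∈? elems S))) (inS σ))
    in InConv-resp-≗ S (λ i → sym (origin+edges≡vertex C σ i)) (∈⇒InConv (elems S) (unique S) vertex∈S)

  fAtLeast-blockLength : ∀ {p q d} → 2 ≤ N → 1 ≤ p → blockLength d q ≤ n → fAtLeast N n p q d
  fAtLeast-blockLength {q = q} {d} 2≤N 1≤p len S density m (_ , maximal) =
    let C , inS = dense⇒blockCube ⦃ >-nonZero (<-≤-trans z<s 2≤N) ⦄ 2≤N d q len (_∈ᵇ S)
                    (DensityAtLeast⇒Dense {q = q} S 1≤p density)
    in maximal d (blockCube⇒HasCube S C inS)

^-distribʳ-* : ∀ m n o → (m * n) ^ o ≡ m ^ o * n ^ o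
^-distribʳ-* m n zero    = refl
^-distribʳ-* m n (suc o) = trans (cong (m * n *_) (^-distribʳ-* m n o)) (interchange m n (m ^ o) (n ^ o))
  where
  interchange : ∀ a b c d → a * b * (c * d) ≡ a * c * (b * d)
  interchange = solve-∀

dyadic-scale : ∀ K .⦃ _ : NonZero K ⦄ {n} → K ≤ n → ∃ λ d → 2 ^ d * K ≤ n × n < 2 ^ suc d * K
dyadic-scale K K≤n with m≤n⇒∃[o]m+o≡n K≤n
... | k , refl = scale k
  where
  scale : ∀ k → ∃ λ d → 2 ^ d * K ≤ K + k × K + k < 2 ^ suc d * K
  scale zero = 0 , ≤-reflexive (trans (*-identityˡ K) (sym (+-identityʳ K))) ,
    subst₂ _<_ (sym (+-identityʳ K)) (*-comm K 2) (m<m*n K 2 ≤-refl)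
  scale (suc k) with scale k
  ... | d , lower , upper with K + suc k <? 2 ^ suc d * K
  ...   | yes upper′ = d , ≤-trans lower (+-monoʳ-≤ K (n≤1+n k)) , upper′
  ...   | no  ≮upper = suc d , ≤-reflexive (sym reached) , subst (_< 2 ^ suc (suc d) * K) (sym reached) doubled
    where
    open ≤-Reasoning
    instance _ = m*n≢0 (2 ^ suc d) K ⦃ m^n≢0 2 (suc d) ⦄
    reached : K + suc k ≡ 2 ^ suc d * K
    reached = ≤-antisym (subst (_≤ 2 ^ suc d * K) (sym (+-suc K k)) upper) (≮⇒≥ ≮upper)
    doubled : 2 ^ suc d * K < 2 ^ suc (suc d) * K
    doubled = begin-strict
      2 ^ suc d * K        <⟨ m<m*n (2 ^ suc d * K) 2 ≤-refl ⟩
      2 ^ suc d * K * 2    ≡⟨ *-comm (2 ^ suc d * K) 2 ⟩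
      2 * (2 ^ suc d * K)  ≡⟨ *-assoc 2 (2 ^ suc d) K ⟨
      2 ^ suc (suc d) * K  ∎

n^[b∸a]≤2^[b*d] : ∀ {n d K} a b .⦃ _ : NonZero n ⦄ → 1 ≤ a →
  n < 2 ^ suc d * K → (2 * K) ^ suc b ≤ n → n ^ (suc b ∸ a) ≤ 2 ^ (suc b * d)
n^[b∸a]≤2^[b*d] {n} {d} {K} a b 1≤a n<2ᵈ⁺¹K [2K]ᵇ≤n =
  *-cancelʳ-≤ (n ^ (suc b ∸ a)) (2 ^ (suc b * d)) n (begin
  n ^ (suc b ∸ a) * n                ≤⟨ *-monoˡ-≤ n (^-monoʳ-≤ n (∸-monoʳ-≤ (suc b) 1≤a)) ⟩
  n ^ b * n                          ≡⟨ *-comm (n ^ b) n ⟩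
  n ^ suc b                          ≤⟨ ^-monoˡ-≤ (suc b) (<⇒≤ n<2ᵈ⁺¹K) ⟩
  (2 ^ suc d * K) ^ suc b            ≡⟨ cong (_^ suc b) (regroup (2 ^ d) K) ⟩
  (2 ^ d * (2 * K)) ^ suc b          ≡⟨ ^-distribʳ-* (2 ^ d) (2 * K) (suc b) ⟩
  (2 ^ d) ^ suc b * (2 * K) ^ suc b  ≡⟨ cong (_* (2 * K) ^ suc b) (^-*-assoc 2 d (suc b)) ⟩
  2 ^ (d * suc b) * (2 * K) ^ suc b  ≡⟨ cong (λ x → 2 ^ x * (2 * K) ^ suc b) (*-comm d (suc b)) ⟩
  2 ^ (suc b * d) * (2 * K) ^ suc b  ≤⟨ *-monoʳ-≤ (2 ^ (suc b * d)) [2K]ᵇ≤n ⟩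
  2 ^ (suc b * d) * n                ∎)
  where
  open ≤-Reasoning
  regroup : ∀ x K → 2 * x * K ≡ x * (2 * K)
  regroup = solve-∀

proposition2p1 : (N : ℕ) → 2 ≤ N →
    (p q : ℕ) → 1 ≤ p → p ≤ q →
    (a b : ℕ) → 1 ≤ a → 1 ≤ b →
    Σ ℕ λ n₀ → (n : ℕ) → n ≥ n₀ →
    Σ ℕ λ k → (n ^ (b ∸ a) ≤ 2 ^ (b * k)) × fAtLeast N n p q k
proposition2p1 N 2≤N p q 1≤p _ a (suc b) 1≤a (s≤s z≤n) = (2 * K) ^ suc b , λ n n≥n₀ →
  let K≤n = ≤-trans (m≤n*m K 2) (≤-trans (m≤m*n (2 * K) ((2 * K) ^ b) ⦃ m^n≢0 (2 * K) b ⦄) n≥n₀)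
      d , lower , upper = dyadic-scale K K≤n
      long-enough = ≤-trans (m≤m+n (blockLength d q) K) (≤-trans (≤-reflexive (blockLength-+ d q)) lower)
  in d , n^[b∸a]≤2^[b*d] {d = d} {K} a b ⦃ >-nonZero (<-≤-trans z<s K≤n) ⦄ 1≤a upper n≥n₀ ,
     GridSets.fAtLeast-blockLength N 2≤N 1≤p long-enough
  where
  K = suc q
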